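{- Let $d$ and $n$ be integers with $1\le d\le n$, and let $E$ be a set of hyperedges of size at most $d$ on $[n]$. If there exists a constant $q\ge1$ such that for any $q+1$ distinct hyperedges $e,e'_1,\dots,e'_q\in E$ it holds that $\left|\bigcup_{i=1}^q e'_i\setminus e\right|=\Omega(d)$, then there exists a trivial two-stage group testing algorithm that finds the defective hyperedge in $E$ and uses $t=O(\log|E|)$ tests.
   Context: Group testing on a hypergraph with vertex set $[n]$ and hyperedge set $E$: exactly one hyperedge $e^*\in E$ is defective. A test on a pool $T\subseteq[n]$ is positive if and only if $T\cap e^*\neq\emptyset$. A two-stage algorithm consists of two stages, each a non-adaptive algorithm (all pools of the stage fixed before testing), where second-stage pools may depend on first-stage responses; it is trivial if the second stage only tests individual elements. The number of tests is the total number of pools over both stages. The asymptotic notation is as in the paper: $\Omega(d)$ means at least $c\,d$ for a fixed constant $c>0$, and the constant hidden in $O(\log|E|)$ may depend on $q$ and $c$. -}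

module Defs where

open import Data.Nat using (ℕ; zero; suc; _+_; _*_; _≤_)
open import Data.Bool using (Bool)
open import Data.Fin using (Fin; zero; suc)
open import Data.Fin.Subset using (Subset; _∩_; _─_; ⋃; ∣_∣; ⁅_⁆; Nonempty)
open import Data.Fin.Subset.Properties using (nonempty?)
open import Data.List using (List; map; length)
open import Data.List.Membership.Propositional using (_∈_)
open import Data.Vec.Functional using () renaming (toList to vtoList)
open import Function.Definitions using (Injective)
open import Relation.Binary.PropositionalEquality using (_≡_)
open import Relation.Nullary.Decidable using (isYes)

test : ∀ {n} → Subset n → Subset n → Bool
test T e = isYes (nonempty? (T ∩ e))

responses : ∀ {n} → List (Subset n) → Subset n → List Bool
responses pools e = map (λ T → test T e) pools

-- A trivial two-stage algorithm: stage 1 is a fixed list of pools;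
-- stage 2 depends on the stage-1 responses and only tests individual
-- elements (pools ⁅ i ⁆); the decoder outputs a hyperedge from all responses.
record TrivialTwoStage (n : ℕ) : Set where
  field
    stage1 : List (Subset n)
    stage2 : List Bool → List (Fin n)
    decode : List Bool → List Bool → Subset n

  stage2Pools : Subset n → List (Subset n)
  stage2Pools e = map ⁅_⁆ (stage2 (responses stage1 e))

  output : Subset n → Subset n
  output e = decode (responses stage1 e) (responses (stage2Pools e) e)

  numTests : Subset n → ℕ
  numTests e = length stage1 + length (stage2Pools e)

open TrivialTwoStage public

Finds : ∀ {n} → TrivialTwoStage n → List (Subset n) → Set
Finds A E = ∀ e → e ∈ E → output A e ≡ e

-- For any q+1 distinct hyperedges e = f zero, e'_i = f (suc i) in E:
-- a * d ≤ b * | (⋃_i e'_i) ∖ e |, i.e. the size is ≥ c*d with c = a/b.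
Separated : ∀ {n} → ℕ → ℕ → ℕ → ℕ → List (Subset n) → Set
Separated {n} q a b d E =
  (f : Fin (suc q) → Subset n) → Injective _≡_ _≡_ f → (∀ i → f i ∈ E) →
  a * d ≤ b * ∣ ⋃ (vtoList (λ i → f (suc i))) ─ f zero ∣

{-# OPTIONS --safe #-}
-- Let a random pool contain each vertex independently with probability 1/(2d). For distinct
-- e, e′₁, …, e′_q ∈ E it misses e with probability at least 1/2, as |e| ≤ d, and then meets
-- (⋃ e′ᵢ) ∖ e, which has at least ad/b elements, with probability at least a/(2b + a). So a
-- fraction a/(4b + 2a) of all pools separates any such tuple, and greedily picking the pool that
-- separates most of the remaining tuples separates all |E|^(q+1) of them with O(q log |E|) pools.
-- After this first stage at most q hyperedges agree with the observed answers, since q + 1 of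
-- them would form a separated tuple; the second stage tests, for every pair of them, a vertex
-- where they differ.
module Submission where

open import Defs

open import Data.Bool using (Bool; true; false; not; _∧_; _∨_; T; if_then_else_)
import Data.Bool as Bool
open import Data.Bool.Properties using (∧-zeroʳ; ∨-identityʳ; T-∨; T-∧; T-not-≡)
open import Data.Bool.Solver using (module ∨-∧-Solver)
open import Data.Fin using (Fin; zero; suc)
open import Data.Fin.Subset using (Subset; _∩_; _∪_; _─_; ⋃; ∣_∣; ⁅_⁆; ⊥; Nonempty)
open import Data.Fin.Subset.Properties using (nonempty?)
open import Data.List using (List; []; _∷_; [_]; _++_; map; length; filter; filterᵇ; replicate; cartesianProductWith; find)
import Data.List.Properties as List
open import Data.List.Properties using (length-++; length-map; length-replicate; length-filter; filter-++; map-cong; ∷-injective)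
open import Data.List.Membership.Propositional using (_∈_)
import Data.List.Membership.Propositional as Membership
open import Data.List.Membership.Propositional.Properties using (∈-cartesianProductWith⁺; ∈-map⁺; ∈-++⁺ˡ; ∈-++⁺ʳ; ∈-filter⁺; ∈-filter⁻; ∈-tabulate⁻)
open import Data.List.Relation.Unary.All using (All; []; _∷_)
import Data.List.Relation.Unary.All as All
import Data.List.Relation.Unary.All.Properties as Allₚ
open import Data.List.Relation.Unary.AllPairs using (_∷_)
open import Data.List.Relation.Unary.Any using (Any; here; there)
open import Data.List.Relation.Unary.Unique.Propositional using (Unique)
import Data.List.Relation.Unary.Unique.Propositional.Properties as Unique
open import Data.Maybe using (just; fromMaybe)
open import Data.Nat
open import Data.Nat.Induction using (<-wellFounded)
open import Data.Nat.ListAction using (sum)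
open import Data.Nat.Logarithm using (⌈log₂_⌉)
open import Data.Nat.Logarithm.Core using (⌈log2⌉)
open import Data.Nat.Properties
open import Data.Nat.Tactic.RingSolver using (solve-∀)
open import Data.Product using (Σ; ∃; _×_; _,_; proj₁; proj₂)
open import Data.Sum using (_⊎_; inj₁; inj₂)
open import Data.Vec using (Vec; []; _∷_; lookup; here; there)
import Data.Vec.Functional as Vector
import Data.Vec.Properties as Vec
open import Function using (_∘_)
open import Function.Bundles using (_⇔_; mk⇔; Equivalence)
open import Function.Definitions using (Injective)
open import Induction.WellFounded using (Acc; acc)
open import Relation.Binary.Definitions using (DecidableEquality)
open import Relation.Binary.PropositionalEquality
  using (_≡_; _≢_; refl; ≢-sym; sym; trans; cong; cong₂; subst; subst₂; module ≡-Reasoning)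
open import Relation.Nullary using (¬_; yes; no; contradiction)
open import Relation.Nullary.Decidable using (T?; does; isYes≗does; does-⇔; _⊎-dec_)
open import Relation.Unary using (Decidable)

private variable
  A B C : Set
  n : ℕ

-- Counting and tuples

count : (A → Bool) → List A → ℕ
count p xs = length (filterᵇ p xs)

count-∷ : ∀ (p : A → Bool) x xs → count p (x ∷ xs) ≡ (if p x then 1 else 0) + count p xs
count-∷ p x xs with p x
... | true  = refl
... | false = refl

count-++ : ∀ (p : A → Bool) xs ys → count p (xs ++ ys) ≡ count p xs + count p ys
count-++ p xs ys = trans (cong length (filter-++ (T? ∘ p) xs ys)) (length-++ (filterᵇ p xs))

count-map : ∀ (p : B → Bool) (f : A → B) xs → count p (map f xs) ≡ count (p ∘ f) xs
count-map p f []       = refl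
count-map p f (x ∷ xs) with p (f x)
... | true  = cong suc (count-map p f xs)
... | false = count-map p f xs

count-cong : ∀ {p r : A → Bool} → (∀ x → p x ≡ r x) → ∀ xs → count p xs ≡ count r xs
count-cong p≗r []       = refl
count-cong {p = p} {r} p≗r (x ∷ xs) = begin
  count p (x ∷ xs)                         ≡⟨ count-∷ p x xs ⟩
  (if p x then 1 else 0) + count p xs      ≡⟨ cong₂ (λ b m → (if b then 1 else 0) + m) (p≗r x) (count-cong p≗r xs) ⟩
  (if r x then 1 else 0) + count r xs      ≡⟨ count-∷ r x xs ⟨
  count r (x ∷ xs)                         ∎
  where open ≡-Reasoning

count-const : ∀ b (xs : List A) → count (λ _ → b) xs ≡ (if b then length xs else 0)
count-const true  []       = refl
count-const true  (x ∷ xs) = cong suc (count-const true xs)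
count-const false []       = refl
count-const false (x ∷ xs) = count-const false xs

count-complement : ∀ (p : A → Bool) xs → length (filterᵇ (not ∘ p) xs) + count p xs ≡ length xs
count-complement p []       = refl
count-complement p (x ∷ xs) with p x
... | true  = trans (+-suc _ _) (cong suc (count-complement p xs))
... | false = cong suc (count-complement p xs)

count-cartesianProductWith : ∀ (f : A → B → C) {p : C → Bool} {r : A → Bool} {s : B → Bool} →
  (∀ x y → p (f x y) ≡ r x ∧ s y) →
  ∀ xs ys → count p (cartesianProductWith f xs ys) ≡ count r xs * count s ys
count-cartesianProductWith f                 split []       ys = refl
count-cartesianProductWith f {p} {r} {s} split (x ∷ xs) ys = begin
  count p (map (f x) ys ++ cartesianProductWith f xs ys)
    ≡⟨ count-++ p (map (f x) ys) _ ⟩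
  count p (map (f x) ys) + count p (cartesianProductWith f xs ys)
    ≡⟨ cong₂ _+_ (trans (count-map p (f x) ys) (count-cong (split x) ys))
                 (count-cartesianProductWith f split xs ys) ⟩
  count (λ y → r x ∧ s y) ys + count r xs * count s ys
    ≡⟨ cong (_+ count r xs * count s ys) (row (r x)) ⟩
  (if r x then 1 else 0) * count s ys + count r xs * count s ys
    ≡⟨ *-distribʳ-+ (count s ys) (if r x then 1 else 0) (count r xs) ⟨
  ((if r x then 1 else 0) + count r xs) * count s ys
    ≡⟨ cong (_* count s ys) (count-∷ r x xs) ⟨
  count r (x ∷ xs) * count s ys ∎
  where
  open ≡-Reasoning
  row : ∀ b → count (λ y → b ∧ s y) ys ≡ (if b then 1 else 0) * count s ys
  row true  = sym (+-identityʳ (count s ys))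
  row false = count-const false ys

count-replicate : ∀ (p : A → Bool) {x} → p x ≡ true → ∀ k → count p (replicate k x) ≡ k
count-replicate p px zero          = refl
count-replicate p {x} px (suc k) =
  trans (count-∷ p x (replicate k x)) (cong₂ (λ b m → (if b then 1 else 0) + m) px (count-replicate p px k))

count-split : ∀ (p r : A → Bool) xs →
  count p xs ≡ count (λ x → p x ∧ r x) xs + count (λ x → p x ∧ not (r x)) xs
count-split p r []       = refl
count-split p r (x ∷ xs) with p x | r x
... | false | _     = count-split p r xs
... | true  | true  = cong suc (count-split p r xs)
... | true  | false = trans (cong suc (count-split p r xs)) (sym (+-suc _ _))

length-cartesianProductWith : ∀ (f : A → B → C) xs ys →
  length (cartesianProductWith f xs ys) ≡ length xs * length ys
length-cartesianProductWith f xs ys = begin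
  length (cartesianProductWith f xs ys)                  ≡⟨ count-const true (cartesianProductWith f xs ys) ⟨
  count (λ _ → true) (cartesianProductWith f xs ys)      ≡⟨ count-cartesianProductWith f (λ _ _ → refl) xs ys ⟩
  count (λ _ → true) xs * count (λ _ → true) ys          ≡⟨ cong₂ _*_ (count-const true xs) (count-const true ys) ⟩
  length xs * length ys                                  ∎
  where open ≡-Reasoning

cartesianPower : ∀ n → List A → List (Vec A n)
cartesianPower zero    xs = [ [] ]
cartesianPower (suc n) xs = cartesianProductWith _∷_ xs (cartesianPower n xs)

length-cartesianPower : ∀ n (xs : List A) → length (cartesianPower n xs) ≡ length xs ^ n
length-cartesianPower zero    xs = refl
length-cartesianPower (suc n) xs =
  trans (length-cartesianProductWith _∷_ xs (cartesianPower n xs)) (cong (length xs *_) (length-cartesianPower n xs))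

∈-cartesianPower : ∀ {xs : List A} (v : Vec A n) → (∀ i → lookup v i ∈ xs) → v ∈ cartesianPower n xs
∈-cartesianPower []      _   = here refl
∈-cartesianPower (x ∷ v) v∈ = ∈-cartesianProductWith⁺ _∷_ (v∈ zero) (∈-cartesianPower v (v∈ ∘ suc))

pick : ∀ {k} (xs : List A) → k ≤ length xs → Vec A k
pick {k = zero}  _        _       = []
pick {k = suc k} (x ∷ xs) (s≤s h) = x ∷ pick xs h

lookup-pick-∈ : ∀ {k} (xs : List A) (h : k ≤ length xs) i → lookup (pick xs h) i ∈ xs
lookup-pick-∈ (x ∷ xs) (s≤s h) zero    = here refl
lookup-pick-∈ (x ∷ xs) (s≤s h) (suc i) = there (lookup-pick-∈ xs h i)

pick-injective : ∀ {k} {xs : List A} (h : k ≤ length xs) → Unique xs → Injective _≡_ _≡_ (lookup (pick xs h))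
pick-injective {xs = x ∷ xs} (s≤s h) (x∉ ∷ unique) {zero}  {zero}  _  = refl
pick-injective {xs = x ∷ xs} (s≤s h) (x∉ ∷ unique) {zero}  {suc j} eq =
  contradiction eq (All.lookup x∉ (lookup-pick-∈ xs h j))
pick-injective {xs = x ∷ xs} (s≤s h) (x∉ ∷ unique) {suc i} {zero}  eq =
  contradiction (sym eq) (All.lookup x∉ (lookup-pick-∈ xs h i))
pick-injective {xs = x ∷ xs} (s≤s h) (x∉ ∷ unique) {suc i} {suc j} eq = cong suc (pick-injective h unique eq)

-- Double counting and greedy covers

sum-map-+ : ∀ (f g : A → ℕ) xs → sum (map (λ x → f x + g x) xs) ≡ sum (map f xs) + sum (map g xs)
sum-map-+ f g []       = refl
sum-map-+ f g (x ∷ xs) = trans (cong (f x + g x +_) (sum-map-+ f g xs)) (interchange (f x) (g x) _ _)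
  where
  interchange : ∀ a b c d → a + b + (c + d) ≡ a + c + (b + d)
  interchange = solve-∀

sum-map-*ˡ : ∀ k (f : A → ℕ) xs → sum (map (λ x → k * f x) xs) ≡ k * sum (map f xs)
sum-map-*ˡ k f []       = sym (*-zeroʳ k)
sum-map-*ˡ k f (x ∷ xs) = trans (cong (k * f x +_) (sum-map-*ˡ k f xs)) (sym (*-distribˡ-+ k (f x) _))

sum-map-≥ : ∀ c (f : A → ℕ) {xs} → All (λ x → c ≤ f x) xs → length xs * c ≤ sum (map f xs)
sum-map-≥ c f []           = z≤n
sum-map-≥ c f (c≤fx ∷ c≤f) = +-mono-≤ c≤fx (sum-map-≥ c f c≤f)

average-witness : ∀ c (f : A → ℕ) xs → 0 < length xs → length xs * c ≤ sum (map f xs) → ∃ λ x → c ≤ f x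
average-witness c f (x ∷ xs) _ le with c ≤? f x
... | yes c≤fx = x , c≤fx
average-witness c f (x ∷ []) _ le | no c≰fx =
  contradiction (subst₂ _≤_ (+-identityʳ c) (+-identityʳ (f x)) le) c≰fx
average-witness c f (x ∷ xs@(_ ∷ _)) _ le | no c≰fx =
  average-witness c f xs (s≤s z≤n) (+-cancelˡ-≤ c _ _ (≤-trans le (+-monoˡ-≤ _ (<⇒≤ (≰⇒> c≰fx)))))

count-as-sum : ∀ (p : A → Bool) xs → count p xs ≡ sum (map (λ x → if p x then 1 else 0) xs)
count-as-sum p []       = refl
count-as-sum p (x ∷ xs) = trans (count-∷ p x xs) (cong ((if p x then 1 else 0) +_) (count-as-sum p xs))

double-counting : ∀ (R : A → B → Bool) xs ys →
  sum (map (λ x → count (R x) ys) xs) ≡ sum (map (λ y → count (λ x → R x y) xs) ys)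
double-counting R [] ys = sym (sum-zero ys)
  where
  sum-zero : ∀ (ys : List B) → sum (map (λ _ → 0) ys) ≡ 0
  sum-zero []       = refl
  sum-zero (y ∷ ys) = sum-zero ys
double-counting R (x ∷ xs) ys = begin
  count (R x) ys + sum (map (λ x → count (R x) ys) xs)
    ≡⟨ cong₂ _+_ (count-as-sum (R x) ys) (double-counting R xs ys) ⟩
  sum (map (λ y → if R x y then 1 else 0) ys) + sum (map (λ y → count (λ z → R z y) xs) ys)
    ≡⟨ sum-map-+ (λ y → if R x y then 1 else 0) (λ y → count (λ z → R z y) xs) ys ⟨
  sum (map (λ y → (if R x y then 1 else 0) + count (λ z → R z y) xs) ys)
    ≡⟨ cong sum (map-cong (λ y → sym (count-∷ (λ z → R z y) x xs)) ys) ⟩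
  sum (map (λ y → count (λ z → R z y) (x ∷ xs)) ys) ∎
  where open ≡-Reasoning

popular-row : ∀ (R : A → B → Bool) a b xs ys → 0 < length xs →
  All (λ y → a * length xs ≤ b * count (λ x → R x y) xs) ys →
  ∃ λ x → a * length ys ≤ b * count (R x) ys
popular-row R a b xs ys xs≢[] dense = average-witness (a * length ys) (λ x → b * count (R x) ys) xs xs≢[] (begin
  length xs * (a * length ys)                      ≡⟨ swap (length xs) a (length ys) ⟩
  length ys * (a * length xs)                      ≤⟨ sum-map-≥ (a * length xs) (λ y → b * count (λ x → R x y) xs) dense ⟩
  sum (map (λ y → b * count (λ x → R x y) xs) ys)  ≡⟨ sum-map-*ˡ b (λ y → count (λ x → R x y) xs) ys ⟩
  b * sum (map (λ y → count (λ x → R x y) xs) ys)  ≡⟨ cong (b *_) (double-counting R xs ys) ⟨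
  b * sum (map (λ x → count (R x) ys) xs)          ≡⟨ sum-map-*ˡ b (λ x → count (R x) ys) xs ⟨
  sum (map (λ x → b * count (R x) ys) xs)          ∎)
  where
  open ≤-Reasoning
  swap : ∀ m a n → m * (a * n) ≡ n * (a * m)
  swap = solve-∀

shrinking-budget : ∀ α a t {m m′ k} → m′ + k ≡ m → a * m ≤ (α + a) * k →
  α ^ suc t * m < (α + a) ^ suc t → α ^ t * m′ < (α + a) ^ t
shrinking-budget α a t {m} {m′} {k} split heavy lt = *-cancelˡ-< β _ _ (begin-strict
  β * (α ^ t * m′)   ≡⟨ rearrange β (α ^ t) m′ ⟩
  α ^ t * (β * m′)   ≤⟨ *-monoʳ-≤ (α ^ t) remaining ⟩
  α ^ t * (α * m)    ≡⟨ rearrange α (α ^ t) m ⟨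
  α * (α ^ t * m)    ≡⟨ *-assoc α (α ^ t) m ⟨
  α ^ suc t * m      <⟨ lt ⟩
  β ^ suc t          ∎)
  where
  open ≤-Reasoning
  β = α + a
  rearrange : ∀ x y z → x * (y * z) ≡ y * (x * z)
  rearrange = solve-∀
  remaining : β * m′ ≤ α * m
  remaining = +-cancelʳ-≤ (a * m) _ _ (begin
    β * m′ + a * m      ≤⟨ +-monoʳ-≤ (β * m′) heavy ⟩
    β * m′ + β * k      ≡⟨ *-distribˡ-+ β m′ k ⟨
    β * (m′ + k)        ≡⟨ cong (β *_) split ⟩
    β * m               ≡⟨ *-distribʳ-+ m α a ⟩
    α * m + a * m       ∎)

Covered : ∀ {Pool Target : Set} → (Pool → Target → Bool) → List Pool → Target → Set
Covered covers cover v = Any (λ P → T (covers P v)) cover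

module _ {Pool Target : Set} (covers : Pool → Target → Bool) (pools : List Pool) (α a : ℕ) where

  Dense : Target → Set
  Dense v = a * length pools ≤ (α + a) * count (λ P → covers P v) pools

  extend-cover : ∀ P cover vs → All (Covered covers cover) (filterᵇ (not ∘ covers P) vs) →
    All (Covered covers (P ∷ cover)) vs
  extend-cover P cover []       _ = []
  extend-cover P cover (v ∷ vs) covered with covers P v in Pv
  ... | true  = here (subst T (sym Pv) _) ∷ extend-cover P cover vs covered
  extend-cover P cover (v ∷ vs) (c ∷ covered) | false = there c ∷ extend-cover P cover vs covered

  greedy-cover : 0 < length pools → ∀ t vs → All Dense vs → α ^ t * length vs < (α + a) ^ t →
    ∃ λ cover → length cover ≤ t × All (Covered covers cover) vs
  greedy-cover _ t [] _ _ = [] , z≤n , []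
  greedy-cover _ zero (v ∷ vs) _ (s≤s ())
  greedy-cover pools≢[] (suc t) vs@(_ ∷ _) dense lt =
    P ∷ cover , s≤s length-cover , extend-cover P cover vs covered
    where
    heaviest = popular-row covers a (α + a) pools vs pools≢[] dense
    P = proj₁ heaviest
    rest = filterᵇ (not ∘ covers P) vs
    recursive = greedy-cover pools≢[] t rest (Allₚ.filter⁺ (T? ∘ not ∘ covers P) dense)
                  (shrinking-budget α a t (count-complement (covers P) vs) (proj₂ heaviest) lt)
    cover = proj₁ recursive
    length-cover = proj₁ (proj₂ recursive)
    covered = proj₂ (proj₂ recursive)

-- Tests and random pools

nonempty-∷ : ∀ s (p : Subset n) → Nonempty (s ∷ p) ⇔ (T s ⊎ Nonempty p)
nonempty-∷ s p = mk⇔ (to s) (from s)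
  where
  to : ∀ s → Nonempty (s ∷ p) → T s ⊎ Nonempty p
  to s (zero  , here)      = inj₁ _
  to s (suc i , there i∈p) = inj₂ (i , i∈p)
  from : ∀ s → T s ⊎ Nonempty p → Nonempty (s ∷ p)
  from true  (inj₁ _)         = zero , here
  from s     (inj₂ (i , i∈p)) = suc i , there i∈p

test-∷ : ∀ x y (P X : Subset n) → test (x ∷ P) (y ∷ X) ≡ (x ∧ y) ∨ test P X
test-∷ x y P X = begin
  test (x ∷ P) (y ∷ X)                ≡⟨ isYes≗does (nonempty? Z) ⟩
  does (nonempty? Z)                  ≡⟨ does-⇔ (nonempty-∷ (x ∧ y) (P ∩ X)) (nonempty? Z) (T? (x ∧ y) ⊎-dec nonempty? (P ∩ X)) ⟩
  (x ∧ y) ∨ does (nonempty? (P ∩ X))  ≡⟨ cong ((x ∧ y) ∨_) (isYes≗does (nonempty? (P ∩ X))) ⟨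
  (x ∧ y) ∨ test P X                  ∎
  where
  open ≡-Reasoning
  Z = (x ∧ y) ∷ (P ∩ X)

test-⊥ˡ : ∀ (X : Subset n) → test ⊥ X ≡ false
test-⊥ˡ []      = refl
test-⊥ˡ (x ∷ X) = trans (test-∷ false x ⊥ X) (test-⊥ˡ X)

test-⊥ʳ : ∀ (P : Subset n) → test P ⊥ ≡ false
test-⊥ʳ []      = refl
test-⊥ʳ (x ∷ P) = trans (test-∷ x false P ⊥) (cong₂ _∨_ (∧-zeroʳ x) (test-⊥ʳ P))

test-∪ : ∀ (P X Y : Subset n) → test P (X ∪ Y) ≡ test P X ∨ test P Y
test-∪ []      []      []      = refl
test-∪ (p ∷ P) (x ∷ X) (y ∷ Y) = begin
  test (p ∷ P) ((x ∨ y) ∷ (X ∪ Y))             ≡⟨ test-∷ p (x ∨ y) P (X ∪ Y) ⟩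
  (p ∧ (x ∨ y)) ∨ test P (X ∪ Y)               ≡⟨ cong ((p ∧ (x ∨ y)) ∨_) (test-∪ P X Y) ⟩
  (p ∧ (x ∨ y)) ∨ (test P X ∨ test P Y)        ≡⟨ distribute p x y (test P X) (test P Y) ⟩
  ((p ∧ x) ∨ test P X) ∨ ((p ∧ y) ∨ test P Y)  ≡⟨ cong₂ _∨_ (test-∷ p x P X) (test-∷ p y P Y) ⟨
  test (p ∷ P) (x ∷ X) ∨ test (p ∷ P) (y ∷ Y)  ∎
  where
  open ≡-Reasoning
  open ∨-∧-Solver using (solve; _:=_; _:+_; _:*_)
  distribute : ∀ p x y a b → (p ∧ (x ∨ y)) ∨ (a ∨ b) ≡ ((p ∧ x) ∨ a) ∨ ((p ∧ y) ∨ b)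
  distribute = solve 5 (λ p x y a b → (p :* (x :+ y)) :+ (a :+ b) := ((p :* x) :+ a) :+ ((p :* y) :+ b)) refl

test-⋃ : ∀ (P : Subset n) ws → T (test P (⋃ ws)) → Any (λ w → T (test P w)) ws
test-⋃ P []       hit = contradiction (subst T (test-⊥ʳ P) hit) λ ()
test-⋃ P (w ∷ ws) hit with Equivalence.to T-∨ (subst T (test-∪ P w (⋃ ws)) hit)
... | inj₁ hit-w  = here hit-w
... | inj₂ hit-ws = there (test-⋃ P ws hit-ws)

test-⁅⁆ : ∀ i (X : Subset n) → test ⁅ i ⁆ X ≡ lookup X i
test-⁅⁆ zero    (x ∷ X) = trans (test-∷ true x ⊥ X) (trans (cong (x ∨_) (test-⊥ˡ X)) (∨-identityʳ x))
test-⁅⁆ (suc i) (x ∷ X) = trans (test-∷ false x ⁅ i ⁆ X) (test-⁅⁆ i X)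

∣p∪q∣≡∣p∣+∣q─p∣ : ∀ (p q : Subset n) → ∣ p ∪ q ∣ ≡ ∣ p ∣ + ∣ q ─ p ∣
∣p∪q∣≡∣p∣+∣q─p∣ []          []          = refl
∣p∪q∣≡∣p∣+∣q─p∣ (true  ∷ p) (_     ∷ q) = cong suc (∣p∪q∣≡∣p∣+∣q─p∣ p q)
∣p∪q∣≡∣p∣+∣q─p∣ (false ∷ p) (true  ∷ q) = trans (cong suc (∣p∪q∣≡∣p∣+∣q─p∣ p q)) (sym (+-suc _ _))
∣p∪q∣≡∣p∣+∣q─p∣ (false ∷ p) (false ∷ q) = ∣p∪q∣≡∣p∣+∣q─p∣ p q

-- Probabilities are counted over this list: a uniformly chosen entry contains each vertex
-- independently with probability 1/(k+1).
poolSpace : ℕ → ∀ n → List (Subset n)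
poolSpace k n = cartesianPower n (true ∷ replicate k false)

missCount : ℕ → Subset n → ℕ
missCount k X = count (λ P → not (test P X)) (poolSpace k _)

separatorCount : ℕ → Subset n → Subset n → ℕ
separatorCount k e Y = count (λ P → not (test P e) ∧ test P Y) (poolSpace k _)

not-∨ : ∀ a b → not (a ∨ b) ≡ not a ∧ not b
not-∨ true  b = refl
not-∨ false b = refl

missCount-∷ : ∀ k b (X : Subset n) →
  missCount k (b ∷ X) ≡ count (λ x → not (x ∧ b)) (true ∷ replicate k false) * missCount k X
missCount-∷ k b X =
  count-cartesianProductWith Data.Vec._∷_
    {p = λ P → not (test P (b ∷ X))} {r = λ x → not (x ∧ b)} {s = λ P → not (test P X)}
    (λ x P → trans (cong not (test-∷ x b P X)) (not-∨ (x ∧ b) (test P X)))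
    (true ∷ replicate k false) (poolSpace k _)

missCount-formula : ∀ k (X : Subset n) → missCount k X * suc k ^ ∣ X ∣ ≡ k ^ ∣ X ∣ * suc k ^ n
missCount-formula k []           = refl
missCount-formula {suc n} k (true ∷ X) = begin
  missCount k (true ∷ X) * (D * D ^ ∣ X ∣)  ≡⟨ cong (_* (D * D ^ ∣ X ∣)) (missCount-∷ k true X) ⟩
  count (λ x → not (x ∧ true)) (true ∷ replicate k false) * missCount k X * (D * D ^ ∣ X ∣)
    ≡⟨ cong (λ c → c * missCount k X * (D * D ^ ∣ X ∣)) (count-replicate (λ x → not (x ∧ true)) refl k) ⟩
  k * missCount k X * (D * D ^ ∣ X ∣)       ≡⟨ rearrange k (missCount k X) D (D ^ ∣ X ∣) ⟩
  k * D * (missCount k X * D ^ ∣ X ∣)       ≡⟨ cong (k * D *_) (missCount-formula k X) ⟩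
  k * D * (k ^ ∣ X ∣ * D ^ n)               ≡⟨ rearrange k D (k ^ ∣ X ∣) (D ^ n) ⟩
  k * k ^ ∣ X ∣ * (D * D ^ n)               ∎
  where
  open ≡-Reasoning
  D = suc k
  rearrange : ∀ a b c d → a * b * (c * d) ≡ a * c * (b * d)
  rearrange = solve-∀
missCount-formula {suc n} k (false ∷ X) = begin
  missCount k (false ∷ X) * D ^ ∣ X ∣   ≡⟨ cong (_* D ^ ∣ X ∣) (missCount-∷ k false X) ⟩
  count (λ x → not (x ∧ false)) (true ∷ replicate k false) * missCount k X * D ^ ∣ X ∣
    ≡⟨ cong (λ c → suc c * missCount k X * D ^ ∣ X ∣) (count-replicate (λ x → not (x ∧ false)) refl k) ⟩
  D * missCount k X * D ^ ∣ X ∣         ≡⟨ *-assoc D (missCount k X) (D ^ ∣ X ∣) ⟩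
  D * (missCount k X * D ^ ∣ X ∣)       ≡⟨ cong (D *_) (missCount-formula k X) ⟩
  D * (k ^ ∣ X ∣ * D ^ n)               ≡⟨ rearrange D (k ^ ∣ X ∣) (D ^ n) ⟩
  k ^ ∣ X ∣ * (D * D ^ n)               ∎
  where
  open ≡-Reasoning
  D = suc k
  rearrange : ∀ a b c → a * (b * c) ≡ b * (a * c)
  rearrange = solve-∀

separatorCount-+-missCount : ∀ k (e Y : Subset n) → separatorCount k e Y + missCount k (e ∪ Y) ≡ missCount k e
separatorCount-+-missCount k e Y = sym (begin
  missCount k e
    ≡⟨ count-split (λ P → not (test P e)) (λ P → test P Y) (poolSpace k _) ⟩
  separatorCount k e Y + count (λ P → not (test P e) ∧ not (test P Y)) (poolSpace k _)
    ≡⟨ cong (separatorCount k e Y +_) (count-cong missBoth (poolSpace k _)) ⟩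
  separatorCount k e Y + missCount k (e ∪ Y) ∎)
  where
  open ≡-Reasoning
  missBoth : ∀ P → not (test P e) ∧ not (test P Y) ≡ not (test P (e ∪ Y))
  missBoth P = trans (sym (not-∨ (test P e) (test P Y))) (cong not (sym (test-∪ P e Y)))

-- Numerical estimates

bernoulli : ∀ α a j → α ^ j * (α + j * a) ≤ α * (α + a) ^ j
bernoulli α a zero    = ≤-reflexive (trans (+-identityʳ _) (trans (+-identityʳ α) (sym (*-identityʳ α))))
bernoulli α a (suc j) = begin
  α * α ^ j * (α + (a + j * a))                      ≡⟨ expand α a j (α ^ j) ⟩
  α * (α ^ j * (α + j * a)) + a * (α * α ^ j)        ≤⟨ +-mono-≤ (*-monoʳ-≤ α (bernoulli α a j))
                                                          (*-monoʳ-≤ a (*-monoʳ-≤ α (^-monoˡ-≤ j (m≤m+n α a)))) ⟩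
  α * (α * (α + a) ^ j) + a * (α * (α + a) ^ j)      ≡⟨ *-distribʳ-+ (α * (α + a) ^ j) α a ⟨
  (α + a) * (α * (α + a) ^ j)                        ≡⟨ regroup α (α + a) ((α + a) ^ j) ⟩
  α * ((α + a) * (α + a) ^ j)                        ∎
  where
  open ≤-Reasoning
  expand : ∀ α a j y → α * y * (α + (a + j * a)) ≡ α * (y * (α + j * a)) + a * (α * y)
  expand = solve-∀
  regroup : ∀ α b y → b * (α * y) ≡ α * (b * y)
  regroup = solve-∀

bernoulli-decay : ∀ k x → suc k * suc k ^ x ≤ suc k * k ^ x + x * suc k ^ x
bernoulli-decay k zero    = m≤m+n (suc k * 1) 0
bernoulli-decay k (suc x) = begin
  D * (D * D ^ x)                                    ≤⟨ *-monoʳ-≤ D (bernoulli-decay k x) ⟩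
  D * (D * k ^ x + x * D ^ x)                        ≡⟨ expand k (k ^ x) x (D ^ x) ⟩
  D * (k * k ^ x) + (D * k ^ x + x * (D * D ^ x))    ≤⟨ +-monoʳ-≤ (D * (k * k ^ x))
                                                          (+-monoˡ-≤ (x * (D * D ^ x)) (*-monoʳ-≤ D (^-monoˡ-≤ x (n≤1+n k)))) ⟩
  D * (k * k ^ x) + (D * D ^ x + x * (D * D ^ x))    ∎
  where
  open ≤-Reasoning
  D = suc k
  expand : ∀ k y x z → (1 + k) * ((1 + k) * y + x * z) ≡ (1 + k) * (k * y) + ((1 + k) * y + x * ((1 + k) * z))
  expand = solve-∀

[1+k]^x≤2*k^x : ∀ {d k x} → d + d ≡ suc k → x ≤ d → suc k ^ x ≤ 2 * k ^ x
[1+k]^x≤2*k^x {suc d′} {k} {x} d+d≡D x≤d = *-cancelˡ-≤ d (+-cancelʳ-≤ (d * D ^ x) _ _ (begin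
  d * D ^ x + d * D ^ x            ≡⟨ *-distribʳ-+ (D ^ x) d d ⟨
  (d + d) * D ^ x                  ≡⟨ cong (_* D ^ x) d+d≡D ⟩
  D * D ^ x                        ≤⟨ bernoulli-decay k x ⟩
  D * k ^ x + x * D ^ x            ≤⟨ +-monoʳ-≤ (D * k ^ x) (*-monoˡ-≤ (D ^ x) x≤d) ⟩
  D * k ^ x + d * D ^ x            ≡⟨ cong (λ c → c * k ^ x + d * D ^ x) d+d≡D ⟨
  (d + d) * k ^ x + d * D ^ x      ≡⟨ cong (_+ d * D ^ x) (double d (k ^ x)) ⟩
  d * (2 * k ^ x) + d * D ^ x      ∎))
  where
  open ≤-Reasoning
  d = suc d′
  D = suc k
  double : ∀ d y → (d + d) * y ≡ d * (2 * y)
  double = solve-∀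

[2b+a]*k^u≤2b*[1+k]^u : ∀ {d k a b u} → d + d ≡ suc k → a * d ≤ b * u → (2 * b + a) * k ^ u ≤ 2 * b * suc k ^ u
[2b+a]*k^u≤2b*[1+k]^u {d} {k} {a} {b} {u} d+d≡D ad≤bu = *-cancelˡ-≤ D (begin
  D * ((2 * b + a) * k ^ u)            ≡⟨ expand D b a (k ^ u) ⟩
  k ^ u * (2 * b * D + a * D)          ≡⟨ cong (λ c → k ^ u * (2 * b * D + a * c)) d+d≡D ⟨
  k ^ u * (2 * b * D + a * (d + d))    ≡⟨ cong (λ c → k ^ u * (2 * b * D + c)) (double a d) ⟩
  k ^ u * (2 * b * D + 2 * (a * d))    ≤⟨ *-monoʳ-≤ (k ^ u) (+-monoʳ-≤ (2 * b * D) (*-monoʳ-≤ 2 ad≤bu)) ⟩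
  k ^ u * (2 * b * D + 2 * (b * u))    ≡⟨ factor (k ^ u) b D u ⟩
  2 * b * (k ^ u * (D + u))            ≤⟨ *-monoʳ-≤ (2 * b) bernoulli-shifted ⟩
  2 * b * (D * D ^ u)                  ≡⟨ regroup b D (D ^ u) ⟩
  D * (2 * b * D ^ u)                  ∎)
  where
  open ≤-Reasoning
  D = suc k
  bernoulli-shifted : k ^ u * (D + u) ≤ D * D ^ u
  bernoulli-shifted = begin
    k ^ u * (D + u)                ≡⟨ split-off k u (k ^ u) ⟩
    k ^ u * (k + u * 1) + k ^ u    ≤⟨ +-mono-≤ (subst (λ c → k ^ u * (k + u * 1) ≤ k * c ^ u) (+-comm k 1) (bernoulli k 1 u))
                                              (^-monoˡ-≤ u (n≤1+n k)) ⟩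
    k * D ^ u + D ^ u              ≡⟨ +-comm (k * D ^ u) (D ^ u) ⟩
    D * D ^ u                      ∎
    where
    split-off : ∀ k u y → y * (1 + k + u) ≡ y * (k + u * 1) + y
    split-off = solve-∀
  expand : ∀ D b a y → D * ((2 * b + a) * y) ≡ y * (2 * b * D + a * D)
  expand = solve-∀
  double : ∀ a d → a * (d + d) ≡ 2 * (a * d)
  double = solve-∀
  factor : ∀ y b D u → y * (2 * b * D + 2 * (b * u)) ≡ 2 * b * (y * (D + u))
  factor = solve-∀
  regroup : ∀ b D y → 2 * b * (D * y) ≡ D * (2 * b * y)
  regroup = solve-∀

-- The fraction K/N is (k/D)^x (1 − (k/D)^u) with D = k + 1; the first factor is at least 1/2
-- and the second at least a/(2b + a).
separation-fraction : ∀ {d k a b x u K Z₁ Z₂ N} → d + d ≡ suc k → x ≤ d → a * d ≤ b * u →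
  K + Z₂ ≡ Z₁ → Z₁ * suc k ^ x ≡ k ^ x * N → Z₂ * suc k ^ (x + u) ≡ k ^ (x + u) * N →
  a * N ≤ (4 * b + a + a) * K
separation-fraction {d} {k} {a} {b} {x} {u} {K} {Z₁} {Z₂} {N} d+d≡D x≤d ad≤bu split Z₁-formula Z₂-formula =
  *-cancelʳ-≤ (a * N) (β * K) (D ^ (x + u)) {{m^n≢0 D (x + u)}} (+-cancelʳ-≤ (β * (k ^ (x + u) * N)) _ _ (begin
    a * N * D ^ (x + u) + β * (k ^ (x + u) * N)
      ≡⟨ cong₂ (λ p q → a * N * p + β * (q * N)) (^-distribˡ-+-* D x u) (^-distribˡ-+-* k x u) ⟩
    a * N * (D ^ x * D ^ u) + β * (k ^ x * k ^ u * N) ≡⟨ collect a N (D ^ x) (D ^ u) β (k ^ x) (k ^ u) ⟩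
    (a * D ^ x * D ^ u + β * k ^ x * k ^ u) * N    ≤⟨ *-monoˡ-≤ N numeric ⟩
    β * k ^ x * D ^ u * N                          ≡⟨ exact ⟩
    β * K * D ^ (x + u) + β * (k ^ (x + u) * N)    ∎))
  where
  open ≤-Reasoning
  D = suc k
  β = 4 * b + a + a
  numeric : a * D ^ x * D ^ u + β * k ^ x * k ^ u ≤ β * k ^ x * D ^ u
  numeric = begin
    a * D ^ x * D ^ u + β * k ^ x * k ^ u
      ≤⟨ +-monoˡ-≤ (β * k ^ x * k ^ u) (*-monoˡ-≤ (D ^ u) (*-monoʳ-≤ a ([1+k]^x≤2*k^x d+d≡D x≤d))) ⟩
    a * (2 * k ^ x) * D ^ u + β * k ^ x * k ^ u  ≡⟨ factor b a (k ^ x) (k ^ u) (D ^ u) ⟩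
    2 * k ^ x * ((2 * b + a) * k ^ u + a * D ^ u)
      ≤⟨ *-monoʳ-≤ (2 * k ^ x) (+-monoˡ-≤ (a * D ^ u) ([2b+a]*k^u≤2b*[1+k]^u {d} {k} {a} {b} {u} d+d≡D ad≤bu)) ⟩
    2 * k ^ x * (2 * b * D ^ u + a * D ^ u)      ≡⟨ unfactor b a (k ^ x) (D ^ u) ⟩
    β * k ^ x * D ^ u                            ∎
    where
    factor : ∀ b a y z w → a * (2 * y) * w + (4 * b + a + a) * y * z ≡ 2 * y * ((2 * b + a) * z + a * w)
    factor = solve-∀
    unfactor : ∀ b a y w → 2 * y * (2 * b * w + a * w) ≡ (4 * b + a + a) * y * w
    unfactor = solve-∀
  exact : β * k ^ x * D ^ u * N ≡ β * K * D ^ (x + u) + β * (k ^ (x + u) * N)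
  exact = begin-equality
    β * k ^ x * D ^ u * N                          ≡⟨ regroup β (k ^ x) (D ^ u) N ⟩
    β * (k ^ x * N) * D ^ u                        ≡⟨ cong (λ c → β * c * D ^ u) Z₁-formula ⟨
    β * (Z₁ * D ^ x) * D ^ u                       ≡⟨ cong (λ c → β * (c * D ^ x) * D ^ u) split ⟨
    β * ((K + Z₂) * D ^ x) * D ^ u                 ≡⟨ distribute β K Z₂ (D ^ x) (D ^ u) ⟩
    β * K * (D ^ x * D ^ u) + β * (Z₂ * (D ^ x * D ^ u)) ≡⟨ cong (λ c → β * K * c + β * (Z₂ * c)) (^-distribˡ-+-* D x u) ⟨
    β * K * D ^ (x + u) + β * (Z₂ * D ^ (x + u))   ≡⟨ cong (λ c → β * K * D ^ (x + u) + β * c) Z₂-formula ⟩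
    β * K * D ^ (x + u) + β * (k ^ (x + u) * N)    ∎
    where
    regroup : ∀ β y z N → β * y * z * N ≡ β * (y * N) * z
    regroup = solve-∀
    distribute : ∀ β K Z y z → β * ((K + Z) * y) * z ≡ β * K * (y * z) + β * (Z * (y * z))
    distribute = solve-∀
  collect : ∀ a N y z β v w → a * N * (y * z) + β * (v * w * N) ≡ (a * y * z + β * v * w) * N
  collect = solve-∀

separating-pools : ∀ {k d a b} (e Y : Subset n) → d + d ≡ suc k → ∣ e ∣ ≤ d → a * d ≤ b * ∣ Y ─ e ∣ →
  a * suc k ^ n ≤ (4 * b + a + a) * separatorCount k e Y
separating-pools {n} {k} {d} {a} {b} e Y d+d≡D e≤d ad≤bu =
  separation-fraction {d} {k} {a} {b} d+d≡D e≤d ad≤bu (separatorCount-+-missCount k e Y) (missCount-formula k e)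
    (subst (λ c → missCount k (e ∪ Y) * suc k ^ c ≡ k ^ c * suc k ^ n) (∣p∪q∣≡∣p∣+∣q─p∣ e Y)
           (missCount-formula k (e ∪ Y)))

n≤2^⌈log₂n⌉ : ∀ n → n ≤ 2 ^ ⌈log₂ n ⌉
n≤2^⌈log₂n⌉ n = bound n (<-wellFounded n)
  where
  bound : ∀ m (rec : Acc _<_ m) → m ≤ 2 ^ ⌈log2⌉ m rec
  bound zero          _         = z≤n
  bound (suc zero)    _         = s≤s z≤n
  bound (suc (suc m)) (acc rec) = begin
    2 + m                          ≡⟨ cong (2 +_) (⌊n/2⌋+⌈n/2⌉≡n m) ⟨
    2 + (⌊ m /2⌋ + ⌈ m /2⌉)        ≤⟨ +-monoʳ-≤ 2 (+-monoˡ-≤ ⌈ m /2⌉ (⌊n/2⌋≤⌈n/2⌉ m)) ⟩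
    2 + (⌈ m /2⌉ + ⌈ m /2⌉)        ≡⟨ double ⌈ m /2⌉ ⟩
    2 * suc ⌈ m /2⌉                ≤⟨ *-monoʳ-≤ 2 (bound (suc ⌈ m /2⌉) (rec (⌈n/2⌉<n m))) ⟩
    2 * 2 ^ ⌈log2⌉ (suc ⌈ m /2⌉) (rec (⌈n/2⌉<n m)) ∎
    where
    open ≤-Reasoning
    double : ∀ c → 2 + (c + c) ≡ 2 * (1 + c)
    double = solve-∀

1≤⌈log₂[2+n]⌉ : ∀ n → 1 ≤ ⌈log₂ (2 + n) ⌉
1≤⌈log₂[2+n]⌉ n with <-wellFounded (2 + n)
... | acc _ = s≤s z≤n

<2^[[2+q]*ℓ] : ∀ {L m ℓ} q → L ≤ m ^ suc q → m ≤ 2 ^ ℓ → 1 ≤ ℓ → L < 2 ^ ((2 + q) * ℓ)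
<2^[[2+q]*ℓ] {L} {m} {ℓ} q L≤ m≤ 1≤ℓ = begin-strict
  L                        ≤⟨ L≤ ⟩
  m ^ suc q                ≤⟨ ^-monoˡ-≤ (suc q) m≤ ⟩
  (2 ^ ℓ) ^ suc q          ≡⟨ ^-*-assoc 2 ℓ (suc q) ⟩
  2 ^ (ℓ * suc q)          <⟨ m<n+m (2 ^ (ℓ * suc q)) (m^n>0 2 (ℓ * suc q)) ⟩
  2 ^ (ℓ * suc q) + 2 ^ (ℓ * suc q)  ≡⟨ cong (2 ^ (ℓ * suc q) +_) (+-identityʳ _) ⟨
  2 * 2 ^ (ℓ * suc q)      ≤⟨ *-monoˡ-≤ (2 ^ (ℓ * suc q)) (^-monoʳ-≤ 2 1≤ℓ) ⟩
  2 ^ ℓ * 2 ^ (ℓ * suc q)  ≡⟨ ^-distribˡ-+-* 2 ℓ (ℓ * suc q) ⟨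
  2 ^ (ℓ + ℓ * suc q)      ≡⟨ cong (2 ^_) (collect q ℓ) ⟩
  2 ^ ((2 + q) * ℓ)        ∎
  where
  open ≤-Reasoning
  collect : ∀ q ℓ → ℓ + ℓ * (1 + q) ≡ (2 + q) * ℓ
  collect = solve-∀

2*α^α≤[α+a]^α : ∀ α a .{{_ : NonZero α}} → 1 ≤ a → 2 * α ^ α ≤ (α + a) ^ α
2*α^α≤[α+a]^α α a 1≤a = *-cancelˡ-≤ α (begin
  α * (2 * α ^ α)          ≡⟨ expand α (α ^ α) ⟩
  α ^ α * (α + α * 1)      ≤⟨ *-monoʳ-≤ (α ^ α) (+-monoʳ-≤ α (*-monoʳ-≤ α 1≤a)) ⟩
  α ^ α * (α + α * a)      ≤⟨ bernoulli α a α ⟩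
  α * (α + a) ^ α          ∎)
  where
  open ≤-Reasoning
  expand : ∀ α y → α * (2 * y) ≡ y * (α + α * 1)
  expand = solve-∀

2^j*α^[αj]≤[α+a]^[αj] : ∀ α a .{{_ : NonZero α}} → 1 ≤ a → ∀ j → 2 ^ j * α ^ (α * j) ≤ (α + a) ^ (α * j)
2^j*α^[αj]≤[α+a]^[αj] α a 1≤a zero    =
  subst (λ c → 2 ^ 0 * α ^ c ≤ (α + a) ^ c) (sym (*-zeroʳ α)) ≤-refl
2^j*α^[αj]≤[α+a]^[αj] α a 1≤a (suc j) =
  subst (λ c → 2 ^ suc j * α ^ c ≤ (α + a) ^ c) (sym (*-suc α j)) (begin
    2 * 2 ^ j * α ^ (α + α * j)          ≡⟨ cong (2 * 2 ^ j *_) (^-distribˡ-+-* α α (α * j)) ⟩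
    2 * 2 ^ j * (α ^ α * α ^ (α * j))    ≡⟨ interchange 2 (2 ^ j) (α ^ α) (α ^ (α * j)) ⟩
    2 * α ^ α * (2 ^ j * α ^ (α * j))    ≤⟨ *-mono-≤ (2*α^α≤[α+a]^α α a 1≤a) (2^j*α^[αj]≤[α+a]^[αj] α a 1≤a j) ⟩
    (α + a) ^ α * (α + a) ^ (α * j)      ≡⟨ ^-distribˡ-+-* (α + a) α (α * j) ⟨
    (α + a) ^ (α + α * j)                ∎)
  where
  open ≤-Reasoning
  interchange : ∀ a b c d → a * b * (c * d) ≡ a * c * (b * d)
  interchange = solve-∀

greedy-budget : ∀ α a .{{_ : NonZero α}} {L m ℓ} q → 1 ≤ a → L ≤ m ^ suc q → m ≤ 2 ^ ℓ → 1 ≤ ℓ →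
  α ^ (α * ((2 + q) * ℓ)) * L < (α + a) ^ (α * ((2 + q) * ℓ))
greedy-budget α a {L} {m} {ℓ} q 1≤a L≤ m≤ 1≤ℓ = begin-strict
  α ^ (α * s) * L      <⟨ *-monoʳ-< (α ^ (α * s)) {{m^n≢0 α (α * s)}} (<2^[[2+q]*ℓ] q L≤ m≤ 1≤ℓ) ⟩
  α ^ (α * s) * 2 ^ s  ≡⟨ *-comm (α ^ (α * s)) (2 ^ s) ⟩
  2 ^ s * α ^ (α * s)  ≤⟨ 2^j*α^[αj]≤[α+a]^[αj] α a 1≤a s ⟩
  (α + a) ^ (α * s)    ∎
  where
  open ≤-Reasoning
  s = (2 + q) * ℓ

-- The two-stage algorithm

firstDifference : Subset (suc n) → Subset (suc n) → Fin (suc n)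
firstDifference {zero}  _       _       = zero
firstDifference {suc n} (x ∷ u) (y ∷ v) = if does (x Bool.≟ y) then suc (firstDifference u v) else zero

lookup-firstDifference : ∀ (u v : Subset (suc n)) → u ≢ v →
  lookup u (firstDifference u v) ≢ lookup v (firstDifference u v)
lookup-firstDifference {zero}  (x ∷ []) (y ∷ []) u≢v x≡y = u≢v (cong (_∷ []) x≡y)
lookup-firstDifference {suc n} (x ∷ u)  (y ∷ v)  u≢v with x Bool.≟ y
... | yes refl = lookup-firstDifference u v (u≢v ∘ cong (x ∷_))
... | no x≢y   = x≢y

distinguishers : List (Subset (suc n)) → List (Fin (suc n))
distinguishers []       = []
distinguishers (u ∷ us) = map (firstDifference u) us ++ distinguishers us

distinguishers-complete : ∀ {u v : Subset (suc n)} us → u ∈ us → v ∈ us → u ≢ v →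
  ∃ λ i → i ∈ distinguishers us × lookup u i ≢ lookup v i
distinguishers-complete (w ∷ us) (here refl) (here refl) u≢v = contradiction refl u≢v
distinguishers-complete (w ∷ us) (here refl) (there v∈us) u≢v =
  _ , ∈-++⁺ˡ (∈-map⁺ (firstDifference w) v∈us) , lookup-firstDifference w _ u≢v
distinguishers-complete (w ∷ us) (there u∈us) (here refl) u≢v =
  _ , ∈-++⁺ˡ (∈-map⁺ (firstDifference w) u∈us) , ≢-sym (lookup-firstDifference w _ (≢-sym u≢v))
distinguishers-complete (w ∷ us) (there u∈us) (there v∈us) u≢v =
  let i , i∈ , differ = distinguishers-complete us u∈us v∈us u≢v
  in  i , ∈-++⁺ʳ (map (firstDifference w) us) i∈ , differ

length-distinguishers : ∀ (us : List (Subset (suc n))) → length (distinguishers us) ≤ length us * length us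
length-distinguishers []       = z≤n
length-distinguishers (u ∷ us) = begin
  length (map (firstDifference u) us ++ distinguishers us)          ≡⟨ length-++ (map (firstDifference u) us) ⟩
  length (map (firstDifference u) us) + length (distinguishers us)  ≡⟨ cong (_+ _) (length-map (firstDifference u) us) ⟩
  m + length (distinguishers us)                                    ≤⟨ +-monoʳ-≤ m (length-distinguishers us) ⟩
  m + m * m                                                         ≤⟨ +-mono-≤ (n≤1+n m) (*-monoʳ-≤ m (n≤1+n m)) ⟩
  suc m * suc m                                                     ∎
  where
  open ≤-Reasoning
  m = length us

find-unique : ∀ {P : A → Set} (P? : Decidable P) {y} xs → y ∈ xs → P y →
  (∀ {x} → x ∈ xs → P x → x ≡ y) → find P? xs ≡ just y
find-unique P? (x ∷ xs) y∈ Py unique with P? x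
... | yes Px = cong just (unique (here refl) Px)
find-unique P? (x ∷ xs) (here refl)  Py unique | no ¬Px = contradiction Py ¬Px
find-unique P? (x ∷ xs) (there y∈xs) Py unique | no ¬Px = find-unique P? xs y∈xs Py (unique ∘ there)

test-agrees : ∀ {P : Subset n} {pools} e e′ → P ∈ pools →
  responses pools e ≡ responses pools e′ → test P e ≡ test P e′
test-agrees {pools = _ ∷ pools} e e′ (here refl)  same = proj₁ (∷-injective same)
test-agrees {pools = _ ∷ pools} e e′ (there P∈)   same = test-agrees e e′ P∈ (proj₂ (∷-injective same))

_≟ʳ_ : DecidableEquality (List Bool)
_≟ʳ_ = List.≡-dec Bool._≟_

_≟ˢ_ : DecidableEquality (Subset n)
_≟ˢ_ = Vec.≡-dec Bool._≟_

module _ (E : List (Subset (suc n))) (stage₁ : List (Subset (suc n))) where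

  candidates : List Bool → List (Subset (suc n))
  candidates r = filter (λ e → responses stage₁ e ≟ʳ r) E

  ∈-candidates⁻ : ∀ {r x} → x ∈ candidates r → x ∈ E × responses stage₁ x ≡ r
  ∈-candidates⁻ {r} = ∈-filter⁻ (λ e → responses stage₁ e ≟ʳ r) {xs = E}

  secondStagePools : List Bool → List (Subset (suc n))
  secondStagePools r = map ⁅_⁆ (distinguishers (candidates r))

  pairwiseAlgorithm : TrivialTwoStage (suc n)
  pairwiseAlgorithm = record
    { stage1 = stage₁
    ; stage2 = λ r → distinguishers (candidates r)
    ; decode = λ r r₂ → fromMaybe ⊥ (find (λ e → responses (secondStagePools r) e ≟ʳ r₂) (candidates r))
    }

  pairwiseAlgorithm-finds : Finds pairwiseAlgorithm E
  pairwiseAlgorithm-finds e e∈E = cong (fromMaybe ⊥) (find-unique _ (candidates r) e-candidate refl unique)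
    where
    r = responses stage₁ e
    e-candidate : e ∈ candidates r
    e-candidate = ∈-filter⁺ (λ e → responses stage₁ e ≟ʳ r) e∈E refl
    unique : ∀ {x} → x ∈ candidates r → responses (secondStagePools r) x ≡ responses (secondStagePools r) e → x ≡ e
    unique {x} x∈ same with x ≟ˢ e
    ... | yes x≡e = x≡e
    ... | no  x≢e =
      let i , i∈ , differ = distinguishers-complete (candidates r) x∈ e-candidate x≢e
          agree = test-agrees x e (∈-map⁺ ⁅_⁆ i∈) same
      in  contradiction (trans (sym (test-⁅⁆ i x)) (trans agree (test-⁅⁆ i e))) differ

  pairwiseAlgorithm-numTests : ∀ {q} → (∀ r → length (candidates r) ≤ q) →
    ∀ e → numTests pairwiseAlgorithm e ≤ length stage₁ + q * q
  pairwiseAlgorithm-numTests {q} small e = +-monoʳ-≤ (length stage₁) (begin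
    length (secondStagePools r)                    ≡⟨ length-map ⁅_⁆ (distinguishers (candidates r)) ⟩
    length (distinguishers (candidates r))         ≤⟨ length-distinguishers (candidates r) ⟩
    length (candidates r) * length (candidates r)  ≤⟨ *-mono-≤ (small r) (small r) ⟩
    q * q                                          ∎)
    where
    open ≤-Reasoning
    r = responses stage₁ e

separates : ∀ {q} → Subset n → Vec (Subset n) (suc q) → Bool
separates P (e ∷ w) = not (test P e) ∧ test P (⋃ (Vector.toList (lookup w)))

SeparatingStage : ∀ q → List (Subset n) → List (Subset n) → Set
SeparatingStage {n} q E stage₁ = ∀ (v : Vec (Subset n) (suc q)) →
  Injective _≡_ _≡_ (lookup v) → (∀ i → lookup v i ∈ E) → Covered separates stage₁ v

module _ {q : ℕ} (E : List (Subset (suc n))) (stage₁ : List (Subset (suc n))) where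

  candidates-unseparated : ∀ {r} (v : Vec (Subset (suc n)) (suc q)) → (∀ i → lookup v i ∈ candidates E stage₁ r) →
    ∀ {P} → P ∈ stage₁ → ¬ T (separates P v)
  candidates-unseparated (e ∷ w) v∈ {P} P∈ sep =
    let miss , hit      = Equivalence.to T-∧ sep
        u , u∈w , hit-u = Membership.find (test-⋃ P (Vector.toList (lookup w)) hit)
        j , u≡wⱼ        = ∈-tabulate⁻ u∈w
        agree           = trans (proj₂ (∈-candidates⁻ E stage₁ (v∈ (suc j))))
                                (sym (proj₂ (∈-candidates⁻ E stage₁ (v∈ zero))))
        hit-e           = subst T (trans (cong (test P) u≡wⱼ) (test-agrees _ e P∈ agree)) hit-u
    in  subst T (Equivalence.to T-not-≡ miss) hit-e

  candidates-≤ : Unique E → SeparatingStage q E stage₁ → ∀ r → length (candidates E stage₁ r) ≤ q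
  candidates-≤ unique separating r with suc q ≤? length (candidates E stage₁ r)
  ... | no  short = ≤-pred (≰⇒> short)
  ... | yes long  =
    let v            = pick (candidates E stage₁ r) long
        v∈           = lookup-pick-∈ (candidates E stage₁ r) long
        injective    = pick-injective long (Unique.filter⁺ _ unique)
        P , P∈ , sep = Membership.find (separating v injective (proj₁ ∘ ∈-candidates⁻ E stage₁ ∘ v∈))
    in  contradiction sep (candidates-unseparated v v∈ P∈)

separating-first-stage : ∀ q a b d′ (E : List (Subset (suc n))) → 1 ≤ a → 1 ≤ ⌈log₂ length E ⌉ →
  All (λ e → ∣ e ∣ ≤ suc d′) E → Separated q a b (suc d′) E →
  ∃ λ stage₁ → length stage₁ ≤ (4 * b + a) * (2 + q) * ⌈log₂ length E ⌉ × SeparatingStage q E stage₁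
separating-first-stage {n} q a b d′ E 1≤a 1≤ℓ small separated =
  proj₁ cover , ≤-trans (proj₁ (proj₂ cover)) (≤-reflexive (sym (*-assoc α (2 + q) ℓ))) , separating
  where
  k = d′ + suc d′
  α = 4 * b + a
  ℓ = ⌈log₂ length E ⌉
  pools = poolSpace k (suc n)
  tuples = cartesianPower (suc q) E
  dense? : Decidable (Dense (separates {q = q}) pools α a)
  dense? v = a * length pools ≤? (α + a) * count (λ P → separates P v) pools
  length-pools : length pools ≡ suc k ^ suc n
  length-pools = trans (length-cartesianPower (suc n) _) (cong (λ c → suc c ^ suc n) (length-replicate k))
  instance
    α≢0 : NonZero α
    α≢0 = >-nonZero (≤-trans 1≤a (m≤n+m a (4 * b)))
  few-tuples : length (filter dense? tuples) ≤ length E ^ suc q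
  few-tuples = ≤-trans (length-filter dense? tuples) (≤-reflexive (length-cartesianPower (suc q) E))
  cover = greedy-cover (separates {q = q}) pools α a (subst (0 <_) (sym length-pools) (m^n>0 (suc k) (suc n)))
            (α * ((2 + q) * ℓ)) (filter dense? tuples) (Allₚ.all-filter dense? tuples)
            (greedy-budget α a q 1≤a few-tuples (n≤2^⌈log₂n⌉ (length E)) 1≤ℓ)
  separating : SeparatingStage q E (proj₁ cover)
  separating v@(e ∷ w) injective v∈E =
    All.lookup (proj₂ (proj₂ cover)) (∈-filter⁺ dense? (∈-cartesianPower v v∈E) dense)
    where
    Y = ⋃ (Vector.toList (lookup w))
    dense : Dense (separates {q = q}) pools α a v
    dense = subst (λ c → a * c ≤ (α + a) * separatorCount k e Y) (sym length-pools)
              (separating-pools {k = k} {suc d′} {a} {b} e Y refl (All.lookup small (v∈E zero))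
                                (separated (lookup v) injective v∈E))

+-≤-*-split : ∀ {s ℓ} c m → s ≤ c * ℓ → 1 ≤ ℓ → s + m ≤ (c + m) * ℓ
+-≤-*-split {s} {ℓ} c m s≤cℓ 1≤ℓ = begin
  s + m          ≤⟨ +-mono-≤ s≤cℓ (≤-trans (≤-reflexive (sym (*-identityʳ m))) (*-monoʳ-≤ m 1≤ℓ)) ⟩
  c * ℓ + m * ℓ  ≡⟨ *-distribʳ-+ ℓ c m ⟨
  (c + m) * ℓ    ∎
  where open ≤-Reasoning

two-stage-algorithm : ∀ q a b d′ (E : List (Subset (suc n))) → 1 ≤ a → 1 ≤ ⌈log₂ length E ⌉ →
  Unique E → All (λ e → ∣ e ∣ ≤ suc d′) E → Separated q a b (suc d′) E →
  Σ (TrivialTwoStage (suc n)) λ A → Finds A E ×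
    (∀ e → e ∈ E → numTests A e ≤ ((4 * b + a) * (2 + q) + q * q) * ⌈log₂ length E ⌉)
two-stage-algorithm q a b d′ E 1≤a 1≤ℓ unique small separated =
  pairwiseAlgorithm E stage₁ , pairwiseAlgorithm-finds E stage₁ , λ e _ →
    ≤-trans (pairwiseAlgorithm-numTests E stage₁ (candidates-≤ E stage₁ unique separating) e)
            (+-≤-*-split ((4 * b + a) * (2 + q)) (q * q) length≤ 1≤ℓ)
  where
  first-stage = separating-first-stage q a b d′ E 1≤a 1≤ℓ small separated
  stage₁ = proj₁ first-stage
  length≤ = proj₁ (proj₂ first-stage)
  separating = proj₂ (proj₂ first-stage)

-- For |E| ≤ 1 the empty first stage leaves at most one candidate, so no test is made at all.
corollary2 : (q : ℕ) → 1 ≤ q → (a b : ℕ) → 0 < a → 0 < b →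
    Σ ℕ λ C → (n d : ℕ) → 1 ≤ d → d ≤ n →
      (E : List (Subset n)) → Unique E → All (λ e → ∣ e ∣ ≤ d) E →
      Separated q a b d E →
      Σ (TrivialTwoStage n) λ A →
        Finds A E × ((e : Subset n) → e ∈ E → numTests A e ≤ C * ⌈log₂ length E ⌉)
corollary2 q _ a b 0<a _ = (4 * b + a) * (2 + q) + q * q , λ where
  zero    (suc d′) _ () _ _ _ _
  (suc n) (suc d′) _ _ [] _ _ _ → pairwiseAlgorithm [] [] , pairwiseAlgorithm-finds [] [] , λ _ ()
  (suc n) (suc d′) _ _ (e ∷ []) _ _ _ → pairwiseAlgorithm [ e ] [] , pairwiseAlgorithm-finds [ e ] [] , λ _ _ → z≤n
  (suc n) (suc d′) _ _ E@(_ ∷ _ ∷ rest) → two-stage-algorithm q a b d′ E 0<a (1≤⌈log₂[2+n]⌉ (length rest))
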